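{- Let $G$ be a multi-orientable three-dimensional GFT graph. (i) If $G$ has exactly two external legs, they do not both carry the label $+$ and do not both carry the label $-$ (no two-point function of type $\phi\phi$ or $\bar\phi\bar\phi$). (ii) If $G$ has exactly four external legs, then two of them carry the label $+$ and two carry the label $-$ (no four-point function of a type other than $\phi\bar\phi\phi\bar\phi$). This holds at any order of perturbation theory, i.e. for graphs with any number of vertices.
   Context: A three-dimensional GFT graph is a graph with 4-valent vertices, each edge consisting of three strands joined without twists, with strand connections at vertices given by the Boulatov vertex; it may have external legs (unpaired half-edges). A GFT graph is multi-orientable if each half-edge (including external legs) can be labeled $+$ or $-$ so that at every vertex there are two $+$ and two $-$ half-edges alternating in the cyclic order ($+,-,+,-$), and every internal edge joins a $-$ half-edge to a $+$ half-edge. These graphs are the Feynman graphs of the action $S[\phi]=\frac12\int\bar\phi\phi+\frac{\lambda}{4!}\int\bar\phi\phi\bar\phi\phi$ for a complex field $\phi$ on $SU(2)^3$, where $\bar\phi$ and $\phi$ correspond to the two labels; the type of an external leg is the field ($\phi$ or $\bar\phi$) attached to it. -}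

module Defs where

open import Data.Nat using (ℕ; zero; suc)
import Data.Fin
open import Data.Fin using (Fin)
import Data.Bool
open import Data.Bool using (Bool; true; false; not)
open import Data.Maybe using (Maybe; just; nothing)
open import Data.Product using (_×_; _,_)
open import Data.List using (List; []; _∷_; allFin; cartesianProduct)
open import Relation.Binary.PropositionalEquality using (_≡_; _≢_)

-- A half-edge of a graph with n four-valent vertices: (vertex, position in the
-- cyclic order 0,1,2,3 at that vertex).  The Boulatov vertex fixes the strand
-- connections at each vertex in terms of this cyclic order, and edges are
-- untwisted, so the strand structure is determined by the data below.
HalfEdge : ℕ → Set
HalfEdge n = Fin n × Fin 4

-- A three-dimensional GFT graph: n vertices, and a partial pairing of
-- half-edges.  partner h ≡ just h' : h is joined by an internal edge to h';
-- partner h ≡ nothing : h is an external leg.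
record GFTGraph : Set where
  field
    nV       : ℕ
    partner  : HalfEdge nV → Maybe (HalfEdge nV)
    partner-sym   : ∀ h h' → partner h ≡ just h' → partner h' ≡ just h
    partner-irrefl : ∀ h h' → partner h ≡ just h' → h ≢ h'

open GFTGraph public

-- Label: true = '+', false = '-'.
record MultiOrientation (G : GFTGraph) : Set where
  field
    label : HalfEdge (nV G) → Bool
    alt₀₂ : ∀ v → label (v , Data.Fin.zero) ≡ label (v , Data.Fin.suc (Data.Fin.suc Data.Fin.zero))
    alt₁₃ : ∀ v → label (v , Data.Fin.suc Data.Fin.zero) ≡ label (v , Data.Fin.suc (Data.Fin.suc (Data.Fin.suc Data.Fin.zero)))
    alt₀₁ : ∀ v → label (v , Data.Fin.zero) ≢ label (v , Data.Fin.suc Data.Fin.zero)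
    edge-opp : ∀ h h' → partner G h ≡ just h' → label h ≢ label h'

open MultiOrientation public

MultiOrientable : GFTGraph → Set
MultiOrientable G = MultiOrientation G

allHalfEdges : (n : ℕ) → List (HalfEdge n)
allHalfEdges n = cartesianProduct (allFin n) (allFin 4)

countB : {A : Set} → (A → Bool) → List A → ℕ
countB p [] = zero
countB p (x ∷ xs) with p x
... | true  = suc (countB p xs)
... | false = countB p xs

isExternal : (G : GFTGraph) → HalfEdge (nV G) → Bool
isExternal G h with partner G h
... | nothing = true
... | just _  = false

numExt : GFTGraph → ℕ
numExt G = countB (isExternal G) (allHalfEdges (nV G))

numExtLabeled : (G : GFTGraph) → MultiOrientation G → Bool → ℕ
numExtLabeled G o b =
  countB (λ h → Data.Bool._∧_ (isExternal G h) (eqB (label o h) b)) (allHalfEdges (nV G))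
  where
    eqB : Bool → Bool → Bool
    eqB true  true  = true
    eqB false false = true
    eqB _     _     = false

module Submission where

-- Count half-edges by label.  Every vertex carries two '+' and
-- two '-' half-edges, so the whole graph has as many '+' half-edges as '-'
-- ones.  Every internal edge joins a '+' to a '-' half-edge, so the map
-- sending an internal half-edge to its partner exchanges internal '+' and
-- internal '-' half-edges; being an involution of the set of all half-edges,
-- it shows that these two counts agree as well.  Subtracting, the external
-- legs are also balanced: #'+'-legs = #'-'-legs.  Hence the number of
-- external legs is twice the number of '+' legs, which forces one leg of
-- each label when there are two legs and two of each when there are four.

open import Defs
open import Data.Bool using (true; false)
open import Data.Nat using (ℕ)
open import Data.Product using (_×_)
open import Relation.Binary.PropositionalEquality using (_≡_; _≢_)

open import Data.Bool using (Bool; not; _∧_)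
open import Data.Bool.Properties using (∧-comm; ∧-zeroʳ; ¬-not)
open import Data.Nat using (zero; suc; _+_)
open import Data.Nat.ListAction using (sum)
open import Data.Nat.Properties using (+-suc; +-cancelʳ-≡; suc-injective)
open import Data.Fin using (Fin)
open import Data.Product using (_,_; ∃)
open import Data.Sum using (_⊎_; inj₁; inj₂)
open import Data.Maybe using (just; nothing; fromMaybe)
open import Data.List using (List; []; _∷_; _++_; map; filter; length; allFin; cartesianProduct)
open import Data.List.Membership.Propositional using (_∈_)
open import Data.List.Membership.Propositional.Properties using (∈-map⁺; ∈-allFin; ∈-cartesianProduct⁺)
open import Data.List.Membership.Propositional.Properties.WithK using (unique∧set⇒bag)
open import Data.List.Relation.Unary.Unique.Propositional using (Unique)
open import Data.List.Relation.Unary.Unique.Propositional.Properties using (map⁺; cartesianProduct⁺; allFin⁺)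
open import Data.List.Relation.Binary.Permutation.Propositional using (_↭_)
open import Data.List.Relation.Binary.Permutation.Propositional.Properties using (↭-length; filter-↭)
open import Relation.Nullary.Decidable using (T?)
open import Data.List.Relation.Binary.BagAndSetEquality using (∼bag⇒↭)
open import Function using (_∘_; mk⇔)
open import Data.Empty using (⊥-elim)
open import Relation.Binary.PropositionalEquality using (refl; sym; trans; cong; cong₂; subst; module ≡-Reasoning)

module _ {A : Set} where

  countB-cong : {p q : A → Bool} → (∀ x → p x ≡ q x) → ∀ xs → countB p xs ≡ countB q xs
  countB-cong {p} {q} p≗q [] = refl
  countB-cong {p} {q} p≗q (x ∷ xs) with p x | q x | p≗q x
  ... | true  | true  | _ = cong suc (countB-cong p≗q xs)
  ... | false | false | _ = countB-cong p≗q xs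

  countB-++ : ∀ (p : A → Bool) xs ys → countB p (xs ++ ys) ≡ countB p xs + countB p ys
  countB-++ p [] ys = refl
  countB-++ p (x ∷ xs) ys with p x
  ... | true  = cong suc (countB-++ p xs ys)
  ... | false = countB-++ p xs ys

  countB-split : ∀ (p q : A → Bool) xs →
    countB p xs ≡ countB (λ x → p x ∧ q x) xs + countB (λ x → p x ∧ not (q x)) xs
  countB-split p q [] = refl
  countB-split p q (x ∷ xs) with p x | q x
  ... | true  | true  = cong suc (countB-split p q xs)
  ... | true  | false = trans (cong suc (countB-split p q xs)) (sym (+-suc _ _))
  ... | false | _     = countB-split p q xs

  -- `countB` agrees with the length of the library's `filter`, which lets us
  -- reuse the library's invariance of filtering under permutations.
  countB-filter : ∀ (p : A → Bool) xs → countB p xs ≡ length (filter (T? ∘ p) xs)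
  countB-filter p [] = refl
  countB-filter p (x ∷ xs) with p x
  ... | true  = cong suc (countB-filter p xs)
  ... | false = countB-filter p xs

  countB-↭ : ∀ (p : A → Bool) {xs ys} → xs ↭ ys → countB p xs ≡ countB p ys
  countB-↭ p {xs} {ys} xs↭ys = begin
    countB p xs                      ≡⟨ countB-filter p xs ⟩
    length (filter (T? ∘ p) xs)      ≡⟨ ↭-length (filter-↭ (T? ∘ p) xs↭ys) ⟩
    length (filter (T? ∘ p) ys)      ≡⟨ sym (countB-filter p ys) ⟩
    countB p ys                      ∎
    where open ≡-Reasoning

  countB-map : ∀ (p : A → Bool) (f : A → A) xs → countB p (map f xs) ≡ countB (p ∘ f) xs
  countB-map p f [] = refl
  countB-map p f (x ∷ xs) with p (f x)
  ... | true  = cong suc (countB-map p f xs)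
  ... | false = countB-map p f xs

  involution-↭ : (f : A → A) → (∀ x → f (f x) ≡ x) →
    ∀ {xs} → Unique xs → (∀ x → x ∈ xs) → map f xs ↭ xs
  involution-↭ f f∘f≡id {xs} unique complete =
    ∼bag⇒↭ (unique∧set⇒bag (map⁺ injective unique) unique
      (λ {x} → mk⇔ (λ _ → complete x) (λ _ → subst (_∈ map f xs) (f∘f≡id x) (∈-map⁺ f (complete (f x))))))
    where
    injective : ∀ {x y} → f x ≡ f y → x ≡ y
    injective {x} {y} fx≡fy = trans (sym (f∘f≡id x)) (trans (cong f fx≡fy) (f∘f≡id y))

  countB-involution : (f : A → A) → (∀ x → f (f x) ≡ x) →
    ∀ {xs} → Unique xs → (∀ x → x ∈ xs) → ∀ p → countB p xs ≡ countB (p ∘ f) xs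
  countB-involution f f∘f≡id {xs} unique complete p =
    trans (sym (countB-↭ p (involution-↭ f f∘f≡id unique complete))) (countB-map p f xs)

indicator : Bool → ℕ
indicator true  = 1
indicator false = 0

countB-sum : {A : Set} (p : A → Bool) (xs : List A) → countB p xs ≡ sum (map (indicator ∘ p) xs)
countB-sum p [] = refl
countB-sum p (x ∷ xs) with p x
... | true  = cong suc (countB-sum p xs)
... | false = countB-sum p xs

alternating-quadruple : ∀ x y z w → x ≡ z → y ≡ w → x ≢ y →
  sum (map indicator (x ∷ y ∷ z ∷ w ∷ [])) ≡ sum (map (indicator ∘ not) (x ∷ y ∷ z ∷ w ∷ []))
alternating-quadruple true  false .true  .false refl refl _ = refl
alternating-quadruple false true  .false .true  refl refl _ = refl
alternating-quadruple true  true  _ _ _ _ x≢y = ⊥-elim (x≢y refl)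
alternating-quadruple false false _ _ _ _ x≢y = ⊥-elim (x≢y refl)

alternating-balanced : {V : Set} (f : V × Fin 4 → Bool) →
  (∀ v → f (v , Data.Fin.zero) ≡ f (v , Data.Fin.suc (Data.Fin.suc Data.Fin.zero))) →
  (∀ v → f (v , Data.Fin.suc Data.Fin.zero) ≡ f (v , Data.Fin.suc (Data.Fin.suc (Data.Fin.suc Data.Fin.zero)))) →
  (∀ v → f (v , Data.Fin.zero) ≢ f (v , Data.Fin.suc Data.Fin.zero)) →
  ∀ vs → countB f (cartesianProduct vs (allFin 4)) ≡ countB (not ∘ f) (cartesianProduct vs (allFin 4))
alternating-balanced f alt₀₂ alt₁₃ alt₀₁ [] = refl
alternating-balanced f alt₀₂ alt₁₃ alt₀₁ (v ∷ vs) = begin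
  countB f (corners ++ rest)                         ≡⟨ countB-++ f corners rest ⟩
  countB f corners + countB f rest                   ≡⟨ cong₂ _+_ vertex (alternating-balanced f alt₀₂ alt₁₃ alt₀₁ vs) ⟩
  countB (not ∘ f) corners + countB (not ∘ f) rest   ≡⟨ sym (countB-++ (not ∘ f) corners rest) ⟩
  countB (not ∘ f) (corners ++ rest)                 ∎
  where
  open ≡-Reasoning
  corners = map (v ,_) (allFin 4)
  rest = cartesianProduct vs (allFin 4)
  vertex : countB f corners ≡ countB (not ∘ f) corners
  vertex = begin
    countB f corners                           ≡⟨ countB-sum f corners ⟩
    sum (map (indicator ∘ f) corners)          ≡⟨ alternating-quadruple _ _ _ _ (alt₀₂ v) (alt₁₃ v) (alt₀₁ v) ⟩
    sum (map (indicator ∘ not ∘ f) corners)    ≡⟨ sym (countB-sum (not ∘ f) corners) ⟩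
    countB (not ∘ f) corners                   ∎

module LabelCounts (G : GFTGraph) (o : MultiOrientation G) where

  halfEdges : List (HalfEdge (nV G))
  halfEdges = allHalfEdges (nV G)

  halfEdges-unique : Unique halfEdges
  halfEdges-unique = cartesianProduct⁺ (allFin⁺ (nV G)) (allFin⁺ 4)

  halfEdges-complete : ∀ h → h ∈ halfEdges
  halfEdges-complete (v , i) = ∈-cartesianProduct⁺ (∈-allFin v) (∈-allFin i)

  ext plus minus : HalfEdge (nV G) → Bool
  ext h = isExternal G h
  plus h = label o h
  minus h = not (label o h)

  opposite : HalfEdge (nV G) → HalfEdge (nV G)
  opposite h = fromMaybe h (partner G h)

  opposite-of-leg : ∀ {h} → partner G h ≡ nothing → opposite h ≡ h
  opposite-of-leg {h} leg = cong (fromMaybe h) leg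

  opposite-of-joined : ∀ {h h'} → partner G h ≡ just h' → opposite h ≡ h'
  opposite-of-joined {h} joined = cong (fromMaybe h) joined

  leg-external : ∀ {h} → partner G h ≡ nothing → ext h ≡ true
  leg-external leg rewrite leg = refl

  joined-internal : ∀ {h h'} → partner G h ≡ just h' → ext h ≡ false
  joined-internal joined rewrite joined = refl

  leg-or-joined : ∀ h → partner G h ≡ nothing ⊎ ∃ λ h' → partner G h ≡ just h'
  leg-or-joined h with partner G h
  ... | nothing = inj₁ refl
  ... | just h' = inj₂ (h' , refl)

  opposite-involutive : ∀ h → opposite (opposite h) ≡ h
  opposite-involutive h with leg-or-joined h
  ... | inj₁ leg = trans (cong opposite (opposite-of-leg leg)) (opposite-of-leg leg)
  ... | inj₂ (h' , joined) = trans (cong opposite (opposite-of-joined joined))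
                                   (opposite-of-joined (partner-sym G h h' joined))

  joined-labels : ∀ {h h'} → partner G h ≡ just h' → minus h' ≡ plus h
  joined-labels {h} {h'} joined = sym (¬-not (edge-opp o h h' joined))

  internal⁺ internal⁻ : HalfEdge (nV G) → Bool
  internal⁺ h = plus h ∧ not (ext h)
  internal⁻ h = minus h ∧ not (ext h)

  opposite-swaps-labels : ∀ h → internal⁻ (opposite h) ≡ internal⁺ h
  opposite-swaps-labels h with leg-or-joined h
  ... | inj₁ leg = begin
    internal⁻ (opposite h)     ≡⟨ cong internal⁻ (opposite-of-leg leg) ⟩
    minus h ∧ not (ext h)      ≡⟨ cong (λ e → minus h ∧ not e) (leg-external leg) ⟩
    minus h ∧ false            ≡⟨ ∧-zeroʳ (minus h) ⟩
    false                      ≡⟨ sym (∧-zeroʳ (plus h)) ⟩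
    plus h ∧ false             ≡⟨ cong (λ e → plus h ∧ not e) (sym (leg-external leg)) ⟩
    internal⁺ h                ∎
    where open ≡-Reasoning
  ... | inj₂ (h' , joined) = begin
    internal⁻ (opposite h)     ≡⟨ cong internal⁻ (opposite-of-joined joined) ⟩
    minus h' ∧ not (ext h')    ≡⟨ cong₂ (λ l e → l ∧ not e) (joined-labels joined)
                                    (joined-internal (partner-sym G h h' joined)) ⟩
    plus h ∧ true              ≡⟨ cong (λ e → plus h ∧ not e) (sym (joined-internal joined)) ⟩
    internal⁺ h                ∎
    where open ≡-Reasoning

  legs⁺ legs⁻ int⁺ int⁻ : ℕ
  legs⁺ = countB (λ h → plus h ∧ ext h) halfEdges
  legs⁻ = countB (λ h → minus h ∧ ext h) halfEdges
  int⁺ = countB internal⁺ halfEdges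
  int⁻ = countB internal⁻ halfEdges

  labels-balanced : countB plus halfEdges ≡ countB minus halfEdges
  labels-balanced = alternating-balanced (label o) (alt₀₂ o) (alt₁₃ o) (alt₀₁ o) (allFin (nV G))

  -- Edge balance: `opposite` exchanges internal '+' and internal '-' half-edges.
  internal-balanced : int⁺ ≡ int⁻
  internal-balanced = begin
    int⁺                                      ≡⟨ countB-cong (sym ∘ opposite-swaps-labels) halfEdges ⟩
    countB (internal⁻ ∘ opposite) halfEdges   ≡⟨ sym (countB-involution opposite opposite-involutive
                                                       halfEdges-unique halfEdges-complete internal⁻) ⟩
    int⁻                                      ∎
    where open ≡-Reasoning

  -- Subtracting the internal counts from the totals balances the legs.
  legs-balanced : legs⁺ ≡ legs⁻
  legs-balanced = +-cancelʳ-≡ int⁺ legs⁺ legs⁻ (begin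
    legs⁺ + int⁺                ≡⟨ sym (countB-split plus ext halfEdges) ⟩
    countB plus halfEdges       ≡⟨ labels-balanced ⟩
    countB minus halfEdges      ≡⟨ countB-split minus ext halfEdges ⟩
    legs⁻ + int⁻                ≡⟨ cong (legs⁻ +_) (sym internal-balanced) ⟩
    legs⁻ + int⁺                ∎)
    where open ≡-Reasoning

  -- Every external leg carries exactly one of the two labels.
  numExt-legs : numExt G ≡ legs⁺ + legs⁻
  numExt-legs = trans (countB-split ext plus halfEdges)
    (cong₂ _+_ (countB-cong (λ h → ∧-comm (ext h) (plus h)) halfEdges)
               (countB-cong (λ h → ∧-comm (ext h) (minus h)) halfEdges))

  -- The predicate counted by `numExtLabeled G o b`; its label comparison is
  -- local to the definition, so the predicate is read off by unification.
  countedBy : {p : HalfEdge (nV G) → Bool} {n : ℕ} → countB p halfEdges ≡ n → HalfEdge (nV G) → Bool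
  countedBy {p} _ = p

  legsLabelled : Bool → HalfEdge (nV G) → Bool
  legsLabelled b = countedBy (refl {x = numExtLabeled G o b})

  numExtLabeled-plus : numExtLabeled G o true ≡ legs⁺
  numExtLabeled-plus = countB-cong pointwise halfEdges
    where
    pointwise : ∀ h → legsLabelled true h ≡ plus h ∧ ext h
    pointwise h with label o h | isExternal G h
    ... | true  | true  = refl
    ... | true  | false = refl
    ... | false | true  = refl
    ... | false | false = refl

  numExtLabeled-minus : numExtLabeled G o false ≡ legs⁻
  numExtLabeled-minus = countB-cong pointwise halfEdges
    where
    pointwise : ∀ h → legsLabelled false h ≡ minus h ∧ ext h
    pointwise h with label o h | isExternal G h
    ... | true  | true  = refl
    ... | true  | false = refl
    ... | false | true  = refl
    ... | false | false = refl

double-injective : ∀ {a b} → a + a ≡ b + b → a ≡ b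
double-injective {zero}  {zero}  _ = refl
double-injective {suc a} {suc b} eq =
  cong suc (double-injective (suc-injective (trans (sym (+-suc a a)) (trans (suc-injective eq) (+-suc b b)))))

theorem5p1 : (G : GFTGraph) → (o : MultiOrientation G) →
    (numExt G ≡ 2 → numExtLabeled G o true ≢ 2 × numExtLabeled G o false ≢ 2)
    × (numExt G ≡ 4 → numExtLabeled G o true ≡ 2 × numExtLabeled G o false ≡ 2)
theorem5p1 G o = two-legs , four-legs
  where
  open LabelCounts G o

  legs-double : numExt G ≡ legs⁺ + legs⁺
  legs-double = trans numExt-legs (cong (legs⁺ +_) (sym legs-balanced))

  legs-of-each : ∀ k → numExt G ≡ k + k → numExtLabeled G o true ≡ k × numExtLabeled G o false ≡ k
  legs-of-each k total = trans numExtLabeled-plus legs⁺≡k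
                       , trans numExtLabeled-minus (trans (sym legs-balanced) legs⁺≡k)
    where
    legs⁺≡k : legs⁺ ≡ k
    legs⁺≡k = double-injective (trans (sym legs-double) total)

  two-legs : numExt G ≡ 2 → numExtLabeled G o true ≢ 2 × numExtLabeled G o false ≢ 2
  two-legs total with legs-of-each 1 total
  ... | plus≡1 , minus≡1 = (λ plus≡2 → one≢two (trans (sym plus≡1) plus≡2))
                         , (λ minus≡2 → one≢two (trans (sym minus≡1) minus≡2))
    where
    one≢two : 1 ≢ 2
    one≢two ()

  four-legs : numExt G ≡ 4 → numExtLabeled G o true ≡ 2 × numExtLabeled G o false ≡ 2
  four-legs = legs-of-each 2
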